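{- Let $G$ be a connected geodetic graph. Then $$\chi_\mu(G)\ge \left\lceil\frac{\mathrm{diam}(G)+1}{2}\right\rceil.$$ Moreover, if $G$ is a block graph, then equality holds.
   Context: A connected graph is geodetic if each pair of its vertices is joined by a unique shortest path. A block graph is a connected graph in which every block (maximal connected subgraph without a cut vertex) is a complete graph. $\mathrm{diam}(G)$ is the diameter. For a connected graph $G$ and $S\subseteq V(G)$, two vertices $x,y\in S$ are $S$-visible if there is a shortest $x,y$-path $P$ in $G$ with $V(P)\cap S=\{x,y\}$. $S$ is a mutual-visibility set if any two vertices of $S$ are $S$-visible. A mutual-visibility coloring of $G$ is a partition of $V(G)$ into mutual-visibility sets, and the mutual-visibility chromatic number $\chi_\mu(G)$ is the smallest number of classes in such a partition. -}

module Defs where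

open import Data.Nat using (ℕ; zero; suc; _≤_; ⌈_/2⌉)
open import Data.Fin using (Fin)
open import Data.List using (List; []; _∷_; length)
open import Data.List.Membership.Propositional using (_∈_)
open import Data.Product using (Σ; ∃; ∃-syntax; _×_; _,_)
open import Data.Sum using (_⊎_)
open import Relation.Nullary using (¬_)
open import Relation.Binary.PropositionalEquality using (_≡_; _≢_)

record Graph (n : ℕ) : Set₁ where
  field
    Adj    : Fin n → Fin n → Set
    sym    : ∀ {x y} → Adj x y → Adj y x
    irrefl : ∀ {x} → ¬ Adj x x
open Graph public

module _ {n : ℕ} (G : Graph n) where

  -- IsWalk x vs y : the vertex sequence x ∷ vs is a walk from x to y in G;
  -- its length (number of edges) is  length vs.
  data IsWalk : Fin n → List (Fin n) → Fin n → Set where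
    nil  : ∀ {x} → IsWalk x [] x
    cons : ∀ {x y z vs} → Adj G x y → IsWalk y vs z → IsWalk x (y ∷ vs) z

  -- a shortest x,y-path (a walk of minimum length; automatically a path)
  IsShortest : Fin n → List (Fin n) → Fin n → Set
  IsShortest x vs y =
    IsWalk x vs y × (∀ ws → IsWalk x ws y → length vs ≤ length ws)

  Connected : Set
  Connected = ∀ x y → ∃[ vs ] IsWalk x vs y

  Dist : Fin n → Fin n → ℕ → Set
  Dist x y d = ∃[ vs ] (IsShortest x vs y × length vs ≡ d)

  IsDiam : ℕ → Set
  IsDiam D = (∀ x y d → Dist x y d → d ≤ D) × (∃[ x ] ∃[ y ] Dist x y D)

  Geodetic : Set
  Geodetic = ∀ x y vs ws → IsShortest x vs y → IsShortest x ws y → vs ≡ ws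

  Visible : (Fin n → Set) → Fin n → Fin n → Set
  Visible S x y = ∃[ vs ] (IsShortest x vs y ×
                    (∀ v → v ∈ (x ∷ vs) → S v → (v ≡ x ⊎ v ≡ y)))

  MutualVisibility : (Fin n → Set) → Set
  MutualVisibility S = ∀ x y → S x → S y → Visible S x y

  -- a mutual-visibility coloring with (at most) k colors: every colour class
  -- is a mutual-visibility set (empty classes are allowed; they can be dropped)
  MVColoring : ℕ → Set
  MVColoring k = Σ (Fin n → Fin k) λ c →
                   ∀ i → MutualVisibility (λ v → c v ≡ i)

  IsChiMu : ℕ → Set
  IsChiMu χ = MVColoring χ × (∀ m → MVColoring m → χ ≤ m)

  record Subgraph : Set₁ where
    field
      V      : Fin n → Set
      E      : Fin n → Fin n → Set
      E-sym  : ∀ {x y} → E x y → E y x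
      E-adj  : ∀ {x y} → E x y → Adj G x y
      E-endl : ∀ {x y} → E x y → V x
  open Subgraph public

  data WalkIn (V : Fin n → Set) (E : Fin n → Fin n → Set) :
         Fin n → Fin n → Set where
    nilᵢ  : ∀ {x} → V x → WalkIn V E x x
    consᵢ : ∀ {x y z} → V x → E x y → WalkIn V E y z → WalkIn V E x z

  SubConnected : Subgraph → Set
  SubConnected H = ∀ x y → V H x → V H y → WalkIn (V H) (E H) x y

  NoCutVertex : Subgraph → Set
  NoCutVertex H = ∀ v → V H v → ∀ x y →
                    V H x → V H y → x ≢ v → y ≢ v →
                    WalkIn (λ u → V H u × u ≢ v)
                           (λ a b → E H a b × a ≢ v × b ≢ v) x y

  Blockish : Subgraph → Set
  Blockish H = SubConnected H × NoCutVertex H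

  _⊆ᴴ_ : Subgraph → Subgraph → Set
  H ⊆ᴴ K = (∀ x → V H x → V K x) × (∀ x y → E H x y → E K x y)

  IsBlock : Subgraph → Set₁
  IsBlock H = Blockish H × (∀ K → Blockish K → H ⊆ᴴ K → K ⊆ᴴ H)

  Complete : Subgraph → Set
  Complete H = ∀ x y → V H x → V H y → x ≢ y → E H x y

  -- every block is a complete graph (connectedness is assumed separately)
  BlockGraph : Set₁
  BlockGraph = ∀ H → IsBlock H → Complete H

ceilHalfSucc : ℕ → ℕ
ceilHalfSucc D = ⌈ suc D /2⌉

-- In a geodetic graph the unique geodesic between two vertices of a mutual-visibility set S
-- contains no third vertex of S, so every colour class meets a diametral geodesic in at most
-- two vertices and D + 1 ≤ 2χ.
--
-- In a block graph the middle vertex v of an induced path u–v–w is a cut vertex, so the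
-- distance to a fixed vertex is unimodal along every geodesic. Colour each vertex by its
-- distance to the middle vertex c of a diametral geodesic, modulo ⌊D/2⌋ + 1: an interior
-- vertex of a geodesic is strictly closer to c than one of its ends, so only the class of c
-- needs care: it also holds the rim at distance ⌊D/2⌋ + 1 from c, and a geodesic through c
-- between two rim vertices would be longer than D.
module Submission where

open import Defs
open import Data.Nat using (ℕ; _≤_)
open import Data.Product using (_×_)
open import Relation.Binary.PropositionalEquality using (_≡_)

open import Data.Nat using (zero; suc; _+_; _∸_; _<_; _≤?_; _≟_; s≤s; s≤s⁻¹; z<s; ⌊_/2⌋; ⌈_/2⌉)
open import Data.Nat.Properties
open import Data.Nat.DivMod using (_%_; _mod_; m≤n⇒m%n≡m; n%n≡0)
open import Data.Nat.Induction using (<-wellFounded)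
open import Data.Fin as F using (Fin; toℕ; fromℕ<; join; splitAt)
open import Data.Fin.Properties using (splitAt-join; pigeonhole; any?; toℕ<n; toℕ-fromℕ<)
open import Data.Fin.Subset using (Subset; _⊂_; _⊃_) renaming (_∈_ to _∈ˢ_)
open import Data.Fin.Subset.Properties using () renaming (_∈?_ to _∈ˢ?_)
open import Data.Fin.Subset.Induction using (⊃-wellFounded)
open import Data.Vec using (tabulate)
open import Data.Vec.Properties using (lookup∘tabulate; lookup⇒[]=; []=⇒lookup)
open import Data.Bool using (true)
open import Data.List using (List; []; _∷_; [_]; length; _++_; take; drop)
open import Data.List.Properties using (length-++; take++drop≡id; length-take; length-drop)
open import Data.List.Membership.Propositional using (_∈_)
open import Data.List.Membership.Propositional.Properties using (∈-++⁻; ∈-++⁺ʳ)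
open import Data.List.Relation.Binary.Subset.Propositional using (_⊆_)
open import Data.List.Relation.Unary.Any using (here; there)
import Data.List.Relation.Unary.All as All
open import Data.List.Relation.Unary.All.Properties using (¬Any⇒All¬)
open import Data.List.Relation.Unary.AllPairs using ([]; _∷_)
open import Data.List.Relation.Unary.Unique.Propositional using (Unique)
open import Data.Product using (∃-syntax; ∃₂; _,_; proj₁; proj₂; map₁)
open import Data.Sum using (_⊎_; inj₁; inj₂)
open import Data.Empty using (⊥)
open import Function using (_∘_; id)
open import Induction.WellFounded using (Acc; acc)
open import Relation.Nullary using (¬_; Dec; yes; no; contradiction; ¬¬-excluded-middle)
open import Relation.Nullary.Decidable using (_×-dec_; does; proof; dec-true; decidable-stable)
open import Relation.Nullary.Reflects using (Reflects; invert)
open import Relation.Binary.PropositionalEquality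
  using (_≢_; refl; cong; cong₂; subst; subst₂; module ≡-Reasoning)
import Relation.Binary.PropositionalEquality as ≡

length-take-drop : ∀ {a} {A : Set a} i k (xs : List A) → i + k ≤ length xs →
                   length (take k (drop i xs)) ≡ k
length-take-drop zero    k xs       i+k≤ = ≡.trans (length-take k xs) (m≤n⇒m⊓n≡m i+k≤)
length-take-drop (suc i) k (x ∷ xs) (s≤s i+k≤) = length-take-drop i k xs i+k≤

mark : ∀ {p a} {P : Set p} {A : Set a} → Dec P → A → A ⊎ A
mark (no _)  = inj₁
mark (yes _) = inj₂

mark-injective : ∀ {p q a} {P : Set p} {Q : Set q} {A : Set a} {x y : A} (p? : Dec P) (q? : Dec Q) →
                 mark p? x ≡ mark q? y → x ≡ y × (Q → P)
mark-injective (no _)  (no ¬q) refl = refl , λ q → contradiction q ¬q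
mark-injective (yes p) (yes _) refl = refl , λ _ → p

join-injective : ∀ m n {i j : Fin m ⊎ Fin n} → join m n i ≡ join m n j → i ≡ j
join-injective m n {i} {j} eq = begin
  i                     ≡⟨ splitAt-join m n i ⟨
  splitAt m (join m n i) ≡⟨ cong (splitAt m) eq ⟩
  splitAt m (join m n j) ≡⟨ splitAt-join m n j ⟩
  j                     ∎
  where open ≡-Reasoning

¬¬-∀ : ∀ {m} {Q : Fin m → Set} → (∀ i → ¬ ¬ Q i) → ¬ ¬ (∀ i → Q i)
¬¬-∀ {zero}      _   k = k λ ()
¬¬-∀ {suc m} {Q} ¬¬Q k = ¬¬Q F.zero λ q₀ → ¬¬-∀ {Q = Q ∘ F.suc} (¬¬Q ∘ F.suc) λ qₛ →
  k λ { F.zero → q₀ ; (F.suc i) → qₛ i }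

¬¬-decidable : ∀ {m} (Q : Fin m → Set) → ¬ ¬ (∀ i → Dec (Q i))
¬¬-decidable Q = ¬¬-∀ λ _ → ¬¬-excluded-middle

suffix-⊆ : ∀ {a} {A : Set a} {x z : A} {xs pre zs} → x ∷ xs ≡ pre ++ z ∷ zs → (z ∷ zs) ⊆ (x ∷ xs)
suffix-⊆ {pre = pre} eq s∈ = subst (_ ∈_) (≡.sym eq) (∈-++⁺ʳ pre s∈)

Unique-++⁻ʳ : ∀ {a} {A : Set a} (xs : List A) {ys} → Unique (xs ++ ys) → Unique ys
Unique-++⁻ʳ []       u       = u
Unique-++⁻ʳ (_ ∷ xs) (_ ∷ u) = Unique-++⁻ʳ xs u

0<k<l≤1+r⇒k%≢l% : ∀ {r k l} → 0 < k → k < l → l ≤ suc r → k % suc r ≢ l % suc r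
0<k<l≤1+r⇒k%≢l% {r} {k} {l} 0<k k<l l≤1+r
  rewrite m≤n⇒m%n≡m (s≤s⁻¹ (≤-trans k<l l≤1+r)) with m≤n⇒m<n∨m≡n l≤1+r
... | inj₁ l<1+r rewrite m≤n⇒m%n≡m (s≤s⁻¹ l<1+r) = <⇒≢ k<l
... | inj₂ refl = subst (k ≢_) (≡.sym (n%n≡0 (suc r))) (≡.≢-sym (<⇒≢ 0<k))

%≡0⇒≡0⊎≡1+r : ∀ {r l} → l ≤ suc r → l % suc r ≡ 0 → l ≡ 0 ⊎ l ≡ suc r
%≡0⇒≡0⊎≡1+r l≤1+r l%≡0 with m≤n⇒m<n∨m≡n l≤1+r
... | inj₁ l<1+r = inj₁ (≡.trans (≡.sym (m≤n⇒m%n≡m (s≤s⁻¹ l<1+r))) l%≡0)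
... | inj₂ l≡1+r = inj₂ l≡1+r

⌊n/2⌋+⌊n/2⌋≤n : ∀ n → ⌊ n /2⌋ + ⌊ n /2⌋ ≤ n
⌊n/2⌋+⌊n/2⌋≤n n = ≤-trans (+-monoʳ-≤ ⌊ n /2⌋ (⌊n/2⌋≤⌈n/2⌉ n)) (≤-reflexive (⌊n/2⌋+⌈n/2⌉≡n n))

n≤⌊n/2⌋+1+⌊n/2⌋ : ∀ n → n ≤ ⌊ n /2⌋ + suc ⌊ n /2⌋
n≤⌊n/2⌋+1+⌊n/2⌋ n =
  ≤-trans (≤-reflexive (≡.sym (⌊n/2⌋+⌈n/2⌉≡n n))) (+-monoʳ-≤ ⌊ n /2⌋ (⌊n/2⌋-mono (n≤1+n (suc n))))

module _ {n : ℕ} {P : Fin n → Set} (P? : ∀ x → Dec (P x)) where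

  fromDec : Subset n
  fromDec = tabulate (does ∘ P?)

  ∈-fromDec⁺ : ∀ {x} → P x → x ∈ˢ fromDec
  ∈-fromDec⁺ {x} px = lookup⇒[]= x fromDec (≡.trans (lookup∘tabulate (does ∘ P?) x) (dec-true (P? x) px))

  ∈-fromDec⁻ : ∀ {x} → x ∈ˢ fromDec → P x
  ∈-fromDec⁻ {x} x∈ = invert (subst (Reflects (P x)) does≡true (proof (P? x)))
    where
    does≡true : does (P? x) ≡ true
    does≡true = ≡.trans (≡.sym (lookup∘tabulate (does ∘ P?) x)) ([]=⇒lookup x∈)

module _ {n : ℕ} (G : Graph n) where

  open import Data.List.Membership.DecPropositional (F._≟_ {n}) using (_∈?_)

  private variable
    x y z : Fin n
    vs ws : List (Fin n)

  _++ʷ_ : IsWalk G x vs y → IsWalk G y ws z → IsWalk G x (vs ++ ws) z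
  nil      ++ʷ q = q
  cons e p ++ʷ q = cons e (p ++ʷ q)

  end∈ : IsWalk G x vs y → y ∈ x ∷ vs
  end∈ nil        = here refl
  end∈ (cons _ p) = there (end∈ p)

  reverseʷ : IsWalk G x vs y → ∃[ ws ] IsWalk G y ws x × length ws ≡ length vs × (y ∷ ws) ⊆ (x ∷ vs)
  reverseʷ nil = [] , nil , refl , λ z∈ → z∈
  reverseʷ {x} (cons {vs = vs} e p) with ws , q , len , ⊆vs ← reverseʷ p =
    ws ++ [ x ] , q ++ʷ cons (sym G e) nil ,
    ≡.trans (length-++ ws) (≡.trans (+-comm (length ws) 1) (cong suc len)) , ⊆x∷vs
    where
    ⊆x∷vs : (_ ∷ ws ++ [ x ]) ⊆ (x ∷ _ ∷ vs)
    ⊆x∷vs (here refl) = there (⊆vs (here refl))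
    ⊆x∷vs (there z∈) with ∈-++⁻ ws z∈
    ... | inj₁ z∈ws       = there (⊆vs (there z∈ws))
    ... | inj₂ (here refl) = here refl

  splitʷ : IsWalk G x vs y → z ∈ x ∷ vs →
           ∃₂ λ us ws → IsWalk G x us z × IsWalk G z ws y × us ++ ws ≡ vs
  splitʷ {vs = vs} p          (here refl) = [] , vs , nil , p , refl
  splitʷ          (cons e p) (there z∈) with us , ws , p₁ , p₂ , refl ← splitʷ p z∈ =
    _ ∷ us , ws , cons e p₁ , p₂ , refl

  suffixʷ : IsWalk G x vs y → z ∈ x ∷ vs → ∃₂ λ pre ws → IsWalk G z ws y × x ∷ vs ≡ pre ++ z ∷ ws
  suffixʷ     p          (here refl) = [] , _ , p , refl
  suffixʷ {x} (cons e p) (there z∈) with pre , ws , q , eq ← suffixʷ p z∈ = x ∷ pre , ws , q , cong (x ∷_) eq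

  -- vertexAt x vs i is the i-th vertex of the walk x ∷ vs; past the end it stays at the last vertex.
  vertexAt : Fin n → List (Fin n) → ℕ → Fin n
  vertexAt x _        zero    = x
  vertexAt x []       (suc i) = x
  vertexAt x (v ∷ vs) (suc i) = vertexAt v vs i

  IsWalk-take : IsWalk G x vs y → ∀ i → IsWalk G x (take i vs) (vertexAt x vs i)
  IsWalk-take p          zero    = nil
  IsWalk-take nil        (suc i) = nil
  IsWalk-take (cons e p) (suc i) = cons e (IsWalk-take p i)

  IsWalk-drop : IsWalk G x vs y → ∀ i → IsWalk G (vertexAt x vs i) (drop i vs) y
  IsWalk-drop p          zero    = p
  IsWalk-drop nil        (suc i) = nil
  IsWalk-drop (cons e p) (suc i) = IsWalk-drop p i

  vertexAt-+ : ∀ x vs i k → vertexAt x vs (i + k) ≡ vertexAt (vertexAt x vs i) (drop i vs) k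
  vertexAt-+ x vs       zero    k = refl
  vertexAt-+ x []       (suc i) zero    = refl
  vertexAt-+ x []       (suc i) (suc k) = refl
  vertexAt-+ x (v ∷ vs) (suc i) k = vertexAt-+ v vs i k

  vertexAt-∈-take : ∀ x vs {j k} → j ≤ k → vertexAt x vs j ∈ x ∷ take k vs
  vertexAt-∈-take x vs       {zero}  _         = here refl
  vertexAt-∈-take x []       {suc j} _         = here refl
  vertexAt-∈-take x (v ∷ vs) {suc j} (s≤s j≤k) = there (vertexAt-∈-take v vs j≤k)

  module _ {x y z : Fin n} {us ws : List (Fin n)} (sh : IsShortest G x (us ++ ws) y)
           (p : IsWalk G x us z) (q : IsWalk G z ws y) where

    IsShortest-++ˡ : IsShortest G x us z
    IsShortest-++ˡ = p , λ vs r → +-cancelʳ-≤ (length ws) (length us) (length vs) (begin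
      length us + length ws   ≡⟨ length-++ us ⟨
      length (us ++ ws)       ≤⟨ proj₂ sh (vs ++ ws) (r ++ʷ q) ⟩
      length (vs ++ ws)       ≡⟨ length-++ vs ⟩
      length vs + length ws   ∎)
      where open ≤-Reasoning

    IsShortest-++ʳ : IsShortest G z ws y
    IsShortest-++ʳ = q , λ vs r → +-cancelˡ-≤ (length us) (length ws) (length vs) (begin
      length us + length ws   ≡⟨ length-++ us ⟨
      length (us ++ ws)       ≤⟨ proj₂ sh (us ++ vs) (p ++ʷ r) ⟩
      length (us ++ vs)       ≡⟨ length-++ us ⟩
      length us + length vs   ∎)
      where open ≤-Reasoning

  module _ {x y : Fin n} {vs : List (Fin n)} (sh : IsShortest G x vs y) (i : ℕ) where

    private
      sh′ : IsShortest G x (take i vs ++ drop i vs) y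
      sh′ = subst (λ us → IsShortest G x us y) (≡.sym (take++drop≡id i vs)) sh

    IsShortest-take : IsShortest G x (take i vs) (vertexAt x vs i)
    IsShortest-take = IsShortest-++ˡ sh′ (IsWalk-take (proj₁ sh) i) (IsWalk-drop (proj₁ sh) i)

    IsShortest-drop : IsShortest G (vertexAt x vs i) (drop i vs) y
    IsShortest-drop = IsShortest-++ʳ sh′ (IsWalk-take (proj₁ sh) i) (IsWalk-drop (proj₁ sh) i)

  IsShortest-segment : IsShortest G x vs y → ∀ i k →
    IsShortest G (vertexAt x vs i) (take k (drop i vs)) (vertexAt x vs (i + k))
  IsShortest-segment {x} {vs} sh i k =
    subst (IsShortest G _ _) (≡.sym (vertexAt-+ x vs i k)) (IsShortest-take (IsShortest-drop sh i) k)

  IsWalk-nonempty : IsWalk G x vs y → x ≢ y → 0 < length vs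
  IsWalk-nonempty nil        x≢y = contradiction refl x≢y
  IsWalk-nonempty (cons _ _) _   = z<s

  IsShortest-chordless : ∀ {w} → IsShortest G x (y ∷ z ∷ vs) w → ¬ Adj G x z × x ≢ z
  IsShortest-chordless (cons _ (cons _ p) , min) =
    (λ x~z → 1+n≰n (min _ (cons x~z p))) , λ { refl → 1+n≰n (≤-trans (n≤1+n _) (min _ p)) }

  IsShortest-loop : IsShortest G x vs x → vs ≡ []
  IsShortest-loop {vs = []}    _         = refl
  IsShortest-loop {vs = _ ∷ _} (_ , min) with () ← min [] nil

  vertexAt-injective : IsShortest G x vs y → ∀ {i j} → i < j → j ≤ length vs →
                       vertexAt x vs i ≢ vertexAt x vs j
  vertexAt-injective {x} {vs} sh {i} {j} i<j j≤len vi≡vj = <⇒≢ (m<n⇒0<n∸m i<j) (begin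
    0                                 ≡⟨ cong length (IsShortest-loop loop) ⟨
    length (take (j ∸ i) (drop i vs)) ≡⟨ length-take-drop i (j ∸ i) vs (≤-trans (≤-reflexive i+k≡j) j≤len) ⟩
    j ∸ i                             ∎)
    where
    open ≡-Reasoning
    i+k≡j = m+[n∸m]≡n (<⇒≤ i<j)
    loop : IsShortest G (vertexAt x vs i) (take (j ∸ i) (drop i vs)) (vertexAt x vs i)
    loop = subst (IsShortest G _ _) (≡.trans (cong (vertexAt x vs) i+k≡j) (≡.sym vi≡vj))
                 (IsShortest-segment sh i (j ∸ i))

  MutualVisibility⇒¬three-on-geodesic : Geodetic G → ∀ {S} → MutualVisibility G S →
    IsShortest G x vs y → ∀ {h i j} → h < i → i < j → j ≤ length vs →
    S (vertexAt x vs h) → S (vertexAt x vs i) → S (vertexAt x vs j) → ⊥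
  MutualVisibility⇒¬three-on-geodesic {x} {vs} geo mv sh {h} {i} {j} h<i i<j j≤len Sh Si Sj
    with Q , shQ , onlyEnds ← mv _ _ Sh Sj
    with onlyEnds (vertexAt x vs i) i∈Q Si
    where
    h≤i = <⇒≤ h<i
    seg = take (j ∸ h) (drop h vs)
    Q≡seg : Q ≡ seg
    Q≡seg = geo _ _ Q seg shQ
      (subst (IsShortest G _ _) (cong (vertexAt x vs) (m+[n∸m]≡n (<⇒≤ (<-trans h<i i<j))))
             (IsShortest-segment sh h (j ∸ h)))
    vi≡ : vertexAt x vs i ≡ vertexAt (vertexAt x vs h) (drop h vs) (i ∸ h)
    vi≡ = ≡.trans (cong (vertexAt x vs) (≡.sym (m+[n∸m]≡n h≤i))) (vertexAt-+ x vs h (i ∸ h))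
    i∈Q : vertexAt x vs i ∈ vertexAt x vs h ∷ Q
    i∈Q = subst₂ (λ v L → v ∈ vertexAt x vs h ∷ L) (≡.sym vi≡) (≡.sym Q≡seg)
                 (vertexAt-∈-take _ (drop h vs) (∸-monoˡ-≤ h (<⇒≤ i<j)))
  ... | inj₁ vi≡vh = vertexAt-injective sh h<i (≤-trans (<⇒≤ i<j) j≤len) (≡.sym vi≡vh)
  ... | inj₂ vi≡vj = vertexAt-injective sh i<j j≤len vi≡vj

  -- Position k is coded by its colour and by whether that colour already occurs before k;
  -- a collision between positions i < j then exhibits three positions h < i < j of one colour.
  geodesic-length-≤ : ∀ {χ} → Geodetic G → MVColoring G χ → IsShortest G x vs y →
                      suc (length vs) ≤ χ + χ
  geodesic-length-≤ {x} {vs} {χ = χ} geo (col , mv) sh =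
    ≮⇒≥ λ χ+χ<1+len → no-collision (pigeonhole χ+χ<1+len code)
    where
    colourAt : ℕ → Fin χ
    colourAt i = col (vertexAt x vs i)

    repeated? : ∀ k → Dec (∃[ h ] colourAt (toℕ {k} h) ≡ colourAt k)
    repeated? k = any? λ h → colourAt (toℕ h) F.≟ colourAt k

    code : Fin (suc (length vs)) → Fin (χ + χ)
    code k = join χ χ (mark (repeated? (toℕ k)) (colourAt (toℕ k)))

    no-collision : ¬ ∃₂ λ i j → i F.< j × code i ≡ code j
    no-collision (i , j , i<j , eq)
      with ci≡cj , earlier ← mark-injective (repeated? _) (repeated? _) (join-injective χ χ eq)
      with h , ch≡ci ← earlier (fromℕ< i<j ,
                               subst (λ t → colourAt t ≡ colourAt (toℕ j)) (≡.sym (toℕ-fromℕ< i<j)) ci≡cj)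
      = MutualVisibility⇒¬three-on-geodesic geo (mv (colourAt (toℕ i))) sh
          (toℕ<n h) i<j (s≤s⁻¹ (toℕ<n j)) ch≡ci refl (≡.sym ci≡cj)

  module _ {V : Fin n → Set} {E : Fin n → Fin n → Set} where

    WalkIn-head : WalkIn G V E x y → V x
    WalkIn-head (nilᵢ v)      = v
    WalkIn-head (consᵢ v _ _) = v

    WalkIn-last : WalkIn G V E x y → V y
    WalkIn-last (nilᵢ v)       = v
    WalkIn-last (consᵢ _ _ q) = WalkIn-last q

    _++ⁱ_ : WalkIn G V E x y → WalkIn G V E y z → WalkIn G V E x z
    nilᵢ _       ++ⁱ r = r
    consᵢ v e q ++ⁱ r = consᵢ v e (q ++ⁱ r)

    WalkIn-reverse : (∀ {a b} → E a b → E b a) → WalkIn G V E x y → WalkIn G V E y x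
    WalkIn-reverse E-symmetric (nilᵢ v)      = nilᵢ v
    WalkIn-reverse E-symmetric (consᵢ v e q) =
      WalkIn-reverse E-symmetric q ++ⁱ consᵢ (WalkIn-head q) (E-symmetric e) (nilᵢ v)

  WalkIn-map : ∀ {V V′ : Fin n → Set} {E E′ : Fin n → Fin n → Set} →
               (∀ {x} → V x → V′ x) → (∀ {x y} → V x → V y → E x y → E′ x y) →
               WalkIn G V E x y → WalkIn G V′ E′ x y
  WalkIn-map f g (nilᵢ v)      = nilᵢ (f v)
  WalkIn-map f g (consᵢ v e q) = consᵢ (f v) (g v (WalkIn-head q) e) (WalkIn-map f g q)

  induced : (Fin n → Set) → Subgraph G
  induced P = record
    { V      = P
    ; E      = λ a b → P a × P b × Adj G a b
    ; E-sym  = λ (pa , pb , e) → pb , pa , sym G e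
    ; E-adj  = λ (_ , _ , e) → e
    ; E-endl = proj₁
    }

  Avoiding : (Fin n → Set) → Fin n → Fin n → Set
  Avoiding P t s = P s × s ≢ t

  Blockish-induced : ∀ {P} →
    (∀ x y → P x → P y → WalkIn G P (Adj G) x y) →
    (∀ t → P t → ∀ x y → P x → P y → x ≢ t → y ≢ t → WalkIn G (Avoiding P t) (Adj G) x y) →
    Blockish G (induced P)
  Blockish-induced connected no-cut =
    (λ x y px py → WalkIn-map id (λ pa pb e → pa , pb , e) (connected x y px py)) ,
    (λ t pt x y px py x≢t y≢t → WalkIn-map id (λ (pa , a≢t) (pb , b≢t) e → (pa , pb , e) , a≢t , b≢t)
                                            (no-cut t pt x y px py x≢t y≢t))

  Blockish⇒Blockish-induced : ∀ H {P} → (∀ {x} → V H x → P x) → (∀ {x} → P x → V H x) →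
                              Blockish G H → Blockish G (induced P)
  Blockish⇒Blockish-induced H to from (connected , no-cut) = Blockish-induced
    (λ x y px py → WalkIn-map to (λ _ _ → E-adj H) (connected x y (from px) (from py)))
    (λ t pt x y px py x≢t y≢t → WalkIn-map (map₁ to) (λ _ _ → E-adj H ∘ proj₁)
                                   (no-cut t (from pt) x y (from px) (from py) x≢t y≢t))

  induced-maximal : ∀ W → Blockish G (induced (_∈ˢ W)) →
    ¬ (∃[ W′ ] W ⊂ W′ × Blockish G (induced (_∈ˢ W′))) → IsBlock G (induced (_∈ˢ W))
  induced-maximal W bl no-larger = bl , λ K blK (W⊆K , _) →
    let K⊆W = ⊆W K blK W⊆K in
    (λ x → K⊆W) , λ a b e → K⊆W (E-endl K e) , K⊆W (E-endl K (E-sym K e)) , E-adj K e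
    where
    ⊆W : ∀ K → Blockish G K → (∀ x → x ∈ˢ W → V K x) → ∀ {x} → V K x → x ∈ˢ W
    ⊆W K blK W⊆K {x} x∈K = decidable-stable (x ∈ˢ? W) λ x∉W → ¬¬-decidable (V K) λ V? →
      no-larger (fromDec V? , ((λ {y} y∈W → ∈-fromDec⁺ V? (W⊆K y y∈W)) , x , ∈-fromDec⁺ V? x∈K , x∉W) ,
                 Blockish⇒Blockish-induced K (∈-fromDec⁺ V?) (∈-fromDec⁻ V?) blK)

  -- W is enlarged along the well-founded _⊂_ until it can no longer grow, and then induces a block.
  BlockGraph⇒Blockish-complete : BlockGraph G → ∀ W → Blockish G (induced (_∈ˢ W)) →
    ∀ {u w} → u ∈ˢ W → w ∈ˢ W → u ≢ w → ¬ ¬ Adj G u w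
  BlockGraph⇒Blockish-complete bg W bl {u} {w} u∈ w∈ u≢w u≁w = go W (⊃-wellFounded W) bl u∈ w∈
    where
    go : ∀ W → Acc _⊃_ W → Blockish G (induced (_∈ˢ W)) → u ∈ˢ W → w ∈ˢ W → ⊥
    go W (acc larger) bl u∈ w∈ =
      u≁w (proj₂ (proj₂ (bg (induced (_∈ˢ W)) (induced-maximal W bl grow) u w u∈ w∈ u≢w)))
      where
      grow : ¬ (∃[ W′ ] W ⊂ W′ × Blockish G (induced (_∈ˢ W′)))
      grow (W′ , W⊂W′ , bl′) = go W′ (larger W⊂W′) bl′ (proj₁ W⊂W′ u∈) (proj₁ W⊂W′ w∈)

  IsWalk⇒WalkIn : ∀ {Q} → IsWalk G x vs y → (∀ {s} → s ∈ x ∷ vs → Q s) → WalkIn G Q (Adj G) x y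
  IsWalk⇒WalkIn nil        q = nilᵢ (q (here refl))
  IsWalk⇒WalkIn (cons e p) q = consᵢ (q (here refl)) e (IsWalk⇒WalkIn p (q ∘ there))

  walk-to-end : ∀ {Q} → IsWalk G x vs y → z ∈ x ∷ vs → (∀ {s} → s ∈ x ∷ vs → Q s) →
                WalkIn G Q (Adj G) z y
  walk-to-end p z∈ q with _ , _ , r , eq ← suffixʷ p z∈ = IsWalk⇒WalkIn r (q ∘ suffix-⊆ eq)

  erase-loops : IsWalk G x vs y → ∃[ ps ] IsWalk G x ps y × Unique (x ∷ ps) × (x ∷ ps) ⊆ (x ∷ vs)
  erase-loops nil = [] , nil , All.[] ∷ [] , id
  erase-loops {x} (cons {y = a} e p) with ps , q , u , ⊆vs ← erase-loops p | x ∈? (a ∷ ps)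
  ... | no x∉  = a ∷ ps , cons e q , ¬Any⇒All¬ _ x∉ ∷ u ,
                 λ { (here refl) → here refl ; (there s∈) → there (⊆vs s∈) }
  ... | yes x∈ with pre , ws , r , eq ← suffixʷ q x∈ =
    ws , r , Unique-++⁻ʳ pre (subst Unique eq u) , there ∘ ⊆vs ∘ suffix-⊆ eq

  simple-walk-avoiding : IsWalk G x vs y → Unique (x ∷ vs) → ∀ {t z} → z ∈ x ∷ vs → z ≢ t →
    WalkIn G (Avoiding (_∈ x ∷ vs) t) (Adj G) z x ⊎ WalkIn G (Avoiding (_∈ x ∷ vs) t) (Adj G) z y
  simple-walk-avoiding p u (here refl) z≢t = inj₁ (nilᵢ (here refl , z≢t))
  simple-walk-avoiding {x} (cons e p) (x∉ ∷ u) {t} (there z∈) z≢t with t F.≟ x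
  ... | yes refl = inj₂ (walk-to-end p z∈ λ s∈ → there s∈ , λ s≡x → All.lookup x∉ s∈ (≡.sym s≡x))
  ... | no t≢x with simple-walk-avoiding p u z∈ z≢t
  ...   | inj₁ q = inj₁ (WalkIn-map (map₁ there) (λ _ _ e → e) q ++ⁱ
                         consᵢ (map₁ there (WalkIn-last q)) (sym G e) (nilᵢ (here refl , t≢x ∘ ≡.sym)))
  ...   | inj₂ q = inj₂ (WalkIn-map (map₁ there) (λ _ _ e → e) q)

  cycle-Blockish : IsWalk G x vs y → Unique (x ∷ vs) → Adj G y x → Blockish G (induced (_∈ x ∷ vs))
  cycle-Blockish {x} {vs} {y} p u y~x = Blockish-induced connected no-cut
    where
    x≢y : x ≢ y
    x≢y refl = irrefl G y~x

    connected : ∀ a b → a ∈ x ∷ vs → b ∈ x ∷ vs → WalkIn G (_∈ x ∷ vs) (Adj G) a b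
    connected a b a∈ b∈ = walk-to-end p a∈ id ++ⁱ WalkIn-reverse (sym G) (walk-to-end p b∈ id)

    to-x : ∀ {t} → t ≢ x → ∀ {z} → z ∈ x ∷ vs → z ≢ t → WalkIn G (Avoiding (_∈ x ∷ vs) t) (Adj G) z x
    to-x t≢x z∈ z≢t with simple-walk-avoiding p u z∈ z≢t
    ... | inj₁ q = q
    ... | inj₂ q = q ++ⁱ consᵢ (WalkIn-last q) y~x (nilᵢ (here refl , t≢x ∘ ≡.sym))

    to-y : ∀ {t} → t ≢ y → ∀ {z} → z ∈ x ∷ vs → z ≢ t → WalkIn G (Avoiding (_∈ x ∷ vs) t) (Adj G) z y
    to-y t≢y z∈ z≢t with simple-walk-avoiding p u z∈ z≢t
    ... | inj₁ q = q ++ⁱ consᵢ (WalkIn-last q) (sym G y~x) (nilᵢ (end∈ p , t≢y ∘ ≡.sym))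
    ... | inj₂ q = q

    no-cut : ∀ t → t ∈ x ∷ vs → ∀ a b → a ∈ x ∷ vs → b ∈ x ∷ vs → a ≢ t → b ≢ t →
             WalkIn G (Avoiding (_∈ x ∷ vs) t) (Adj G) a b
    no-cut t _ a b a∈ b∈ a≢t b≢t with t F.≟ x
    ... | no t≢x   = to-x t≢x a∈ a≢t ++ⁱ WalkIn-reverse (sym G) (to-x t≢x b∈ b≢t)
    ... | yes refl = to-y x≢y a∈ a≢t ++ⁱ WalkIn-reverse (sym G) (to-y x≢y b∈ b≢t)

  -- A u–w walk avoiding v closes, after loop erasure, into a cycle through u, v and w; the cycle
  -- induces a blockish subgraph, which would make u and w adjacent.
  BlockGraph⇒cut-vertex : BlockGraph G → ∀ {u v w} → Adj G u v → Adj G v w → ¬ Adj G u w → u ≢ w →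
                          IsWalk G u vs w → v ∈ u ∷ vs
  BlockGraph⇒cut-vertex {vs} bg {u} {v} {w} u~v v~w u≁w u≢w p = decidable-stable (v ∈? u ∷ vs) λ v∉ →
    let ps , q , unique , ⊆vs = erase-loops p
        cycle = cycle-Blockish (cons (sym G u~v) q) (¬Any⇒All¬ _ (v∉ ∘ ⊆vs) ∷ unique) (sym G v~w)
        C? = _∈? v ∷ u ∷ ps
    in BlockGraph⇒Blockish-complete bg (fromDec C?)
         (Blockish⇒Blockish-induced (induced (_∈ v ∷ u ∷ ps)) (∈-fromDec⁺ C?) (∈-fromDec⁻ C?) cycle)
         (∈-fromDec⁺ C? (there (here refl))) (∈-fromDec⁺ C? (there (end∈ q))) u≢w u≁w

  module Metric (adj? : ∀ x y → Dec (Adj G x y)) (conn : Connected G) where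

    walk-of-length? : ∀ ℓ x y → Dec (∃[ vs ] IsWalk G x vs y × length vs ≡ ℓ)
    walk-of-length? zero x y with x F.≟ y
    ... | yes refl = yes ([] , nil , refl)
    ... | no x≢y   = no λ { ([] , nil , _) → x≢y refl ; (_ ∷ _ , _ , ()) }
    walk-of-length? (suc ℓ) x y with any? (λ z → adj? x z ×-dec walk-of-length? ℓ z y)
    ... | yes (z , e , vs , p , refl) = yes (z ∷ vs , cons e p , refl)
    ... | no none = no λ { ([] , _ , ()) ; (z ∷ vs , cons e p , refl) → none (z , e , vs , p , refl) }

    shortest-walk : IsWalk G x vs y → ∃[ ps ] IsShortest G x ps y
    shortest-walk p = go p (<-wellFounded _)
      where
      go : IsWalk G x vs y → Acc _<_ (length vs) → ∃[ ps ] IsShortest G x ps y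
      go {x} {vs} {y} p (acc rec) with any? (λ (ℓ : Fin (length vs)) → walk-of-length? (toℕ ℓ) x y)
      ... | yes (ℓ , ws , q , len≡ℓ) = go q (rec (≡.subst (_< length vs) (≡.sym len≡ℓ) (toℕ<n ℓ)))
      ... | no none = vs , p , λ ws q → ≮⇒≥ λ ws<vs → none (fromℕ< ws<vs , ws , q , ≡.sym (toℕ-fromℕ< ws<vs))

    geodesic : Fin n → Fin n → List (Fin n)
    geodesic x y = proj₁ (shortest-walk (proj₂ (conn x y)))

    geodesic-shortest : ∀ x y → IsShortest G x (geodesic x y) y
    geodesic-shortest x y = proj₂ (shortest-walk (proj₂ (conn x y)))

    geodesic-walk : ∀ x y → IsWalk G x (geodesic x y) y
    geodesic-walk x y = proj₁ (geodesic-shortest x y)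

    dist : Fin n → Fin n → ℕ
    dist x y = length (geodesic x y)

    dist-≤ : IsWalk G x vs y → dist x y ≤ length vs
    dist-≤ {x} {y = y} p = proj₂ (geodesic-shortest x y) _ p

    dist-sym : ∀ x y → dist x y ≡ dist y x
    dist-sym x y = ≤-antisym (dist-≤-reverse x y) (dist-≤-reverse y x)
      where
      dist-≤-reverse : ∀ x y → dist x y ≤ dist y x
      dist-≤-reverse x y with ws , p , len , _ ← reverseʷ (geodesic-walk y x) =
        ≤-trans (dist-≤ p) (≤-reflexive len)

    dist≡0⇒≡ : dist x y ≡ 0 → x ≡ y
    dist≡0⇒≡ {x} {y} d≡0 with geodesic x y | geodesic-walk x y | d≡0
    ... | [] | nil | _ = refl

    dist-<-on-walk : IsWalk G x vs y → z ∈ x ∷ vs → z ≢ y → dist x z < length vs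
    dist-<-on-walk p z∈ z≢y with splitʷ p z∈
    ... | us , [] , _ , nil , _ = contradiction refl z≢y
    ... | us , w ∷ ws , q , _ , refl = begin-strict
      dist _ _                ≤⟨ dist-≤ q ⟩
      length us               <⟨ m<m+n (length us) z<s ⟩
      length us + length (w ∷ ws) ≡⟨ length-++ us ⟨
      length (us ++ w ∷ ws)   ∎
      where open ≤-Reasoning

    IsDiam⇒dist-≤ : ∀ {D} → IsDiam G D → ∀ x y → dist x y ≤ D
    IsDiam⇒dist-≤ (bounded , _) x y = bounded x y _ (geodesic x y , geodesic-shortest x y , refl)

    module _ (bg : BlockGraph G) where

      -- Otherwise the walk u → y → w along geodesics would avoid the cut vertex v.
      dist-no-peak : ∀ y {u v w} → Adj G u v → Adj G v w → ¬ Adj G u w → u ≢ w →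
                     dist y u ≤ dist y v → dist y w ≤ dist y v → ⊥
      dist-no-peak y {u} {v} {w} u~v v~w u≁w u≢w du≤dv dw≤dv
        with us , yu , _ , ⊆geo ← reverseʷ (geodesic-walk y u)
        with ∈-++⁻ (u ∷ us) (BlockGraph⇒cut-vertex bg u~v v~w u≁w u≢w (yu ++ʷ geodesic-walk y w))
      ... | inj₁ v∈ = <⇒≱ (dist-<-on-walk (geodesic-walk y u) (⊆geo v∈) v≢u) du≤dv
        where
        v≢u : v ≢ u
        v≢u refl = irrefl G u~v
      ... | inj₂ v∈ = <⇒≱ (dist-<-on-walk (geodesic-walk y w) (there v∈) v≢w) dw≤dv
        where
        v≢w : v ≢ w
        v≢w refl = irrefl G v~w

      dist-increasing : ∀ y {p q rest b} → IsShortest G p (q ∷ rest) b → dist y p ≤ dist y q →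
                        dist y q + length rest ≤ dist y b
      dist-increasing y (cons _ nil , _) _ = ≤-reflexive (+-identityʳ _)
      dist-increasing y {p} {q} {s ∷ rest} {b} sh@(cons p~q (cons q~s _) , _) dp≤dq = begin
        dist y q + suc (length rest) ≡⟨ +-suc (dist y q) (length rest) ⟩
        suc (dist y q) + length rest ≤⟨ +-monoˡ-≤ (length rest) dq<ds ⟩
        dist y s + length rest       ≤⟨ dist-increasing y (IsShortest-drop sh 1) (<⇒≤ dq<ds) ⟩
        dist y b                     ∎
        where
        open ≤-Reasoning
        dq<ds : dist y q < dist y s
        dq<ds = ≰⇒> λ ds≤dq → let p≁s , p≢s = IsShortest-chordless sh in
                               dist-no-peak y p~q q~s p≁s p≢s dp≤dq ds≤dq

      dist-interior-≤ : ∀ y {a m b pre suf} → IsWalk G a pre m → IsWalk G m suf b →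
                        IsShortest G a (pre ++ suf) b →
                        dist y m + length pre ≤ dist y a ⊎ dist y m + length suf ≤ dist y b
      dist-interior-≤ y nil _ _ = inj₁ (≤-reflexive (+-identityʳ _))
      dist-interior-≤ y {a} {m} {b} {a′ ∷ pre} {suf} (cons e p) q sh
        with dist-interior-≤ y p q (IsShortest-drop sh 1)
      ... | inj₂ closer-to-b = inj₂ closer-to-b
      ... | inj₁ closer-to-a′ with dist y a ≤? dist y a′
      ...   | no  da≰da′ = inj₁ (begin
        dist y m + suc (length pre) ≡⟨ +-suc (dist y m) (length pre) ⟩
        suc (dist y m + length pre) ≤⟨ s≤s closer-to-a′ ⟩
        suc (dist y a′)             ≤⟨ ≰⇒> da≰da′ ⟩
        dist y a                    ∎)
        where open ≤-Reasoning
      ...   | yes da≤da′ = inj₂ (begin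
        dist y m + length suf                ≤⟨ +-monoˡ-≤ (length suf) (m≤m+n (dist y m) (length pre)) ⟩
        dist y m + length pre + length suf   ≤⟨ +-monoˡ-≤ (length suf) closer-to-a′ ⟩
        dist y a′ + length suf               ≤⟨ +-monoʳ-≤ (dist y a′) (m≤n+m (length suf) (length pre)) ⟩
        dist y a′ + (length pre + length suf) ≡⟨ cong (dist y a′ +_) (length-++ pre) ⟨
        dist y a′ + length (pre ++ suf)      ≤⟨ dist-increasing y sh da≤da′ ⟩
        dist y b                             ∎)
        where open ≤-Reasoning

      centre : ∀ {D} → IsDiam G D → ∃[ c ] ∀ z → dist c z ≤ suc ⌊ D /2⌋
      centre diam@(_ , a , b , vs , sh , refl) = c , λ z → begin
        dist c z ≡⟨ dist-sym c z ⟩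
        dist z c ≤⟨ +-cancelʳ-≤ r (dist z c) (suc r) (≤-trans (reach z)
                      (≤-trans (n≤⌊n/2⌋+1+⌊n/2⌋ (length vs)) (≤-reflexive (+-comm r (suc r))))) ⟩
        suc r    ∎
        where
        open ≤-Reasoning
        r = ⌊ length vs /2⌋
        c = vertexAt a vs r
        sh′ : IsShortest G a (take r vs ++ drop r vs) b
        sh′ = subst (λ l → IsShortest G a l b) (≡.sym (take++drop≡id r vs)) sh
        reach : ∀ z → dist z c + r ≤ length vs
        reach z with dist-interior-≤ z (IsWalk-take (proj₁ sh) r) (IsWalk-drop (proj₁ sh) r) sh′
        ... | inj₁ closer-to-a = ≤-trans (≤-reflexive (cong (dist z c +_) (≡.sym |take|)))
                                         (≤-trans closer-to-a (IsDiam⇒dist-≤ diam z a))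
          where
          |take| : length (take r vs) ≡ r
          |take| = ≡.trans (length-take r vs) (m≤n⇒m⊓n≡m (⌊n/2⌋≤n (length vs)))
        ... | inj₂ closer-to-b = ≤-trans (+-monoʳ-≤ (dist z c) r≤|drop|)
                                         (≤-trans closer-to-b (IsDiam⇒dist-≤ diam z b))
          where
          r≤|drop| : r ≤ length (drop r vs)
          r≤|drop| = subst (r ≤_) (≡.sym (length-drop r vs)) (m+n≤o⇒m≤o∸n r (⌊n/2⌋+⌊n/2⌋≤n (length vs)))

      distance-colouring : ∀ c r → (∀ z → dist c z ≤ suc r) → (∀ x y → dist x y ≤ r + suc r) →
                           MVColoring G (suc r)
      distance-colouring c r ecc bounded = colour , λ i x y cx≡i cy≡i →
        geodesic x y , geodesic-shortest x y , λ v v∈ cv≡i →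
          ends-only v∈ (≡.trans cv≡i (≡.sym cx≡i)) (≡.trans cv≡i (≡.sym cy≡i))
        where
        colour : Fin n → Fin (suc r)
        colour z = dist c z mod suc r

        level : Fin n → ℕ
        level z = dist c z % suc r

        colour⇒level : ∀ {u v} → colour u ≡ colour v → level u ≡ level v
        colour⇒level eq = ≡.trans (≡.sym (toℕ-fromℕ< _)) (≡.trans (cong toℕ eq) (toℕ-fromℕ< _))

        rim : ∀ {z} → z ≢ c → 0 ≡ level z → dist c z ≡ suc r
        rim z≢c 0≡lz with %≡0⇒≡0⊎≡1+r (ecc _) (≡.sym 0≡lz)
        ... | inj₁ d≡0   = contradiction (≡.sym (dist≡0⇒≡ d≡0)) z≢c
        ... | inj₂ d≡1+r = d≡1+r

        no-interior : ∀ {x y v} → v ∈ x ∷ geodesic x y → v ≢ x → v ≢ y →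
                      level v ≡ level x → level v ≡ level y → ⊥
        no-interior {x} {y} {v} v∈ v≢x v≢y lv≡lx lv≡ly
          with us , ws , p₁ , p₂ , us++ws≡ ← splitʷ (geodesic-walk x y) v∈
          with dist c v ≟ 0
        ... | yes dv≡0 with refl ← dist≡0⇒≡ dv≡0 = 1+n≰n (+-cancelʳ-≤ (suc r) (suc r) r (begin
          suc r + suc r           ≡⟨ cong₂ _+_ (≡.trans (≡.sym (rim (v≢x ∘ ≡.sym) 0≡lx)) (dist-sym c x))
                                              (≡.sym (rim (v≢y ∘ ≡.sym) 0≡ly)) ⟩
          dist x c + dist c y     ≤⟨ +-mono-≤ (dist-≤ p₁) (dist-≤ p₂) ⟩
          length us + length ws   ≡⟨ ≡.trans (≡.sym (length-++ us)) (cong length us++ws≡) ⟩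
          dist x y                ≤⟨ bounded x y ⟩
          r + suc r               ∎))
          where
          open ≤-Reasoning
          0≡lx = ≡.trans (cong (_% suc r) (≡.sym dv≡0)) lv≡lx
          0≡ly = ≡.trans (cong (_% suc r) (≡.sym dv≡0)) lv≡ly
        ... | no dv≢0
          with dist-interior-≤ c p₁ p₂
                 (subst (λ l → IsShortest G x l y) (≡.sym us++ws≡) (geodesic-shortest x y))
        ...   | inj₁ closer-to-x =
          0<k<l≤1+r⇒k%≢l% (n≢0⇒n>0 dv≢0)
            (<-≤-trans (m<m+n _ (IsWalk-nonempty p₁ (v≢x ∘ ≡.sym))) closer-to-x) (ecc x) lv≡lx
        ...   | inj₂ closer-to-y =
          0<k<l≤1+r⇒k%≢l% (n≢0⇒n>0 dv≢0)
            (<-≤-trans (m<m+n _ (IsWalk-nonempty p₂ v≢y)) closer-to-y) (ecc y) lv≡ly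

        ends-only : ∀ {x y v} → v ∈ x ∷ geodesic x y → colour v ≡ colour x → colour v ≡ colour y →
                    v ≡ x ⊎ v ≡ y
        ends-only {x} {y} {v} v∈ cv≡cx cv≡cy with v F.≟ x | v F.≟ y
        ... | yes v≡x | _       = inj₁ v≡x
        ... | no _    | yes v≡y = inj₂ v≡y
        ... | no v≢x  | no v≢y  = contradiction (colour⇒level cv≡cx) λ lv≡lx →
                                    no-interior v∈ v≢x v≢y lv≡lx (colour⇒level cv≡cy)

      diameter-colouring : ∀ {D} → IsDiam G D → MVColoring G (suc ⌊ D /2⌋)
      diameter-colouring {D} diam with c , ecc ← centre diam =
        distance-colouring c ⌊ D /2⌋ ecc λ x y → ≤-trans (IsDiam⇒dist-≤ diam x y) (n≤⌊n/2⌋+1+⌊n/2⌋ D)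

proposition5p1 : ∀ (n : ℕ) (G : Graph n) → Connected G → Geodetic G →
                   ∀ (χ D : ℕ) → IsChiMu G χ → IsDiam G D →
                   (ceilHalfSucc D ≤ χ) × (BlockGraph G → χ ≡ ceilHalfSucc D)
proposition5p1 n G conn geo χ D (colouring , minimal) diam = lower , upper
  where
  lower : ceilHalfSucc D ≤ χ
  lower with _ , _ , vs , sh , refl ← proj₂ diam = begin
    ⌈ suc (length vs) /2⌉ ≤⟨ ⌈n/2⌉-mono (geodesic-length-≤ G geo colouring sh) ⟩
    ⌈ χ + χ /2⌉          ≡⟨ n≡⌈n+n/2⌉ χ ⟨
    χ                    ∎
    where open ≤-Reasoning

  -- Adjacency is decidable only under double negation, which suffices since χ ≤ ⌈(D+1)/2⌉ is decidable.
  upper : BlockGraph G → χ ≡ ceilHalfSucc D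
  upper bg = ≤-antisym (decidable-stable (χ ≤? ceilHalfSucc D) λ χ≰ →
    ¬¬-∀ (λ x → ¬¬-decidable (Adj G x)) λ adj? →
      χ≰ (minimal _ (Metric.diameter-colouring G adj? conn bg diam))) lower
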